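{- Let $t\in\mathbb N^+$, let $D$ be an oriented graph with $\delta^0(D)\ge t$, and let $w\in V(D)$. Then $D$ has a connected antimatching $M=\{a_ib_i\}_{1\le i\le t}$ of size $t$ with $a_1=w$.
   Context: An oriented graph is a digraph with no loops and at most one edge between any pair of vertices; $uv$ denotes an edge directed from $u$ to $v$. $\delta^0(D)$ is the minimum over all vertices of their in- and out-degrees. An antiwalk is a sequence of vertices $v_0v_1\dots v_\ell$ ($\ell\ge0$; vertices and edges may repeat) such that each consecutive pair forms an edge of $D$ and the directions of consecutive edges alternate. An out-out-walk from $a$ to $z$ is either the trivial walk $a$ (when $z=a$), or a nontrivial antiwalk $a=v_0,\dots,v_\ell=z$ whose first edge is $v_0v_1$ (directed away from $a$) and whose last edge is $v_\ell v_{\ell-1}$ (directed away from $z$). $\mathrm{Out}(D,a)$ is the set of vertices $z$ such that there is an out-out-walk from $a$ to $z$ in $D$. A connected antimatching of size $m$ in $D$ is a set $M=\{a_ib_i\}_{1\le i\le m}$ of edges of $D$ (each directed from $a_i$ to $b_i$) forming a matching in the underlying graph, such that $a_i\in\mathrm{Out}(D,a_1)$ for every $1\le i\le m$. -}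

module Defs where

open import Data.Nat using (ℕ; _≤_; suc)
open import Data.Fin using (Fin; zero)
open import Data.Fin.Subset using (Subset; ∣_∣)
open import Data.Vec using (tabulate)
open import Data.Bool using (Bool; true; false)
open import Data.Product using (_×_; Σ)
open import Relation.Binary.PropositionalEquality using (_≡_; _≢_)
open import Relation.Nullary using (¬_)

-- A finite digraph on vertex set Fin n, given by its (decidable) adjacency:
-- E u v ≡ true  means that uv (from u to v) is an edge.
Digraph : ℕ → Set
Digraph n = Fin n → Fin n → Bool

Edge : ∀ {n} → Digraph n → Fin n → Fin n → Set
Edge E u v = E u v ≡ true

Oriented : ∀ {n} → Digraph n → Set
Oriented {n} E = (∀ u → ¬ Edge E u u) × (∀ u v → Edge E u v → ¬ Edge E v u)

outDeg : ∀ {n} → Digraph n → Fin n → ℕ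
outDeg E u = ∣ tabulate (λ v → E u v) ∣

inDeg : ∀ {n} → Digraph n → Fin n → ℕ
inDeg E u = ∣ tabulate (λ v → E v u) ∣

MinSemiDegAtLeast : ∀ {n} → Digraph n → ℕ → Set
MinSemiDegAtLeast E t = ∀ u → (t ≤ outDeg E u) × (t ≤ inDeg E u)

-- Either trivial (z = a), or an out-out-walk a … x (whose last edge points
-- away from x, i.e. is backward) extended by the two edges x→y and z→y;
-- directions keep alternating (forward, backward), the first edge of the
-- whole walk is out of a and the last edge is out of z.
data OutOutWalk {n} (E : Digraph n) (a : Fin n) : Fin n → Set where
  trivial : OutOutWalk E a a
  extend  : ∀ {x y z} → OutOutWalk E a x → Edge E x y → Edge E z y →
            OutOutWalk E a z

InOut : ∀ {n} → Digraph n → Fin n → Fin n → Set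
InOut E a z = OutOutWalk E a z

-- A connected antimatching of size m (m ≥ 1, written suc k): edges
-- a i → b i (i : Fin (suc k)), forming a matching in the underlying graph
-- (all 2m endpoints pairwise distinct), with every a i ∈ Out(D, a₁),
-- where a₁ is a zero.
record ConnectedAntimatching {n} (E : Digraph n) (k : ℕ) : Set where
  field
    a b       : Fin (suc k) → Fin n
    isEdge    : ∀ i → Edge E (a i) (b i)
    a-inj     : ∀ i j → a i ≡ a j → i ≡ j
    b-inj     : ∀ i j → b i ≡ b j → i ≡ j
    a≢b       : ∀ i j → a i ≢ b j
    connected : ∀ i → InOut E (a zero) (a i)

{-# OPTIONS --safe #-}
-- Induction on the size, inside a set A of surviving vertices in which every vertex keeps
-- t out- and t in-neighbours.  Pick an out-neighbour y of w and delete it: degrees drop by at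
-- most one, so induction yields an antimatching M of size t - 1 rooted at w avoiding y.  For
-- each pair a_j b_j of M block b_j if b_j → y and a_j otherwise; as y has t in-neighbours, one
-- of them, x, is unblocked.  If x is not in M, add the pair xy (x ∈ Out via w → y ← x).
-- Otherwise x = a_j and b_j → y: replacing the pair by a_j y frees c = b_j ∈ Out (via
-- w → y ← c).  As D is oriented, c has 2t neighbours in A, more than the 2t - 1 vertices of M
-- and y, so some neighbour z is free, and cz or zc (via a_j → c ← z) completes the antimatching.
module Submission where

open import Defs
open import Data.Nat using (ℕ; zero; suc; _+_; _≤_; _<_; z≤n; s≤s)
open import Data.Nat.Properties
  using (+-identityʳ; +-suc; m≤m+n; +-mono-≤; +-monoʳ-<; n<1+n; ≤-trans; ≤-reflexive; ≤-pred; ≤-<-trans; ≤⇒≯;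
         module ≤-Reasoning)
open import Data.Fin using (Fin; zero; suc; punchIn; punchOut)
open import Data.Fin.Properties using (_≟_; punchIn-punchOut)
open import Data.Fin.Subset
open import Data.Fin.Subset.Properties
  using (x∈⁅x⁆; x∈⁅y⁆⇒x≡y; ∣⁅x⁆∣≡1; Empty-unique; ∣⊥∣≡0; ∉⊥; ∈⊤; p⊆q⇒∣p∣≤∣q∣; _∈?_; nonempty?; ∩-identityʳ;
         x∈p∩q⁺; x∈p∩q⁻; x∈p∪q⁺; x∈p∪q⁻; x∈p∧x≢y⇒x∈p-y; x∈p∧x∉q⇒x∈p─q; p─q⊆p)
open import Data.Vec using (_∷_; []; tabulate; here; there)
open import Data.Vec.Properties using ([]=⇒lookup; lookup∘tabulate)
open import Data.Vec.Functional using (Vector; insertAt; updateAt)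
open import Data.Vec.Functional.Properties using (insertAt-lookup; insertAt-punchIn; updateAt-updates; updateAt-minimal)
open import Data.Bool using (Bool; true; false; if_then_else_)
open import Data.Product using (Σ; _×_; _,_; ∃; proj₁; proj₂)
open import Data.Sum using (inj₁; inj₂)
open import Data.Empty using (⊥-elim)
open import Function using (_∘_; const)
open import Function.Definitions using (Injective)
open import Relation.Nullary using (yes; no; contradiction)
open import Relation.Binary.PropositionalEquality

private variable
  m n : ℕ
  X Y : Set

x∈p─q⇒x∉q : ∀ {x : Fin n} (p q : Subset n) → x ∈ p ─ q → x ∉ q
x∈p─q⇒x∉q (s ∷ p) (outside ∷ q) here       ()
x∈p─q⇒x∉q (s ∷ p) (t ∷ q)       (there x∈) (there x∈q) = x∈p─q⇒x∉q p q x∈ x∈q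

x∈p-y⇒x≢y : ∀ {x y : Fin n} (p : Subset n) → x ∈ p - y → x ≢ y
x∈p-y⇒x≢y {y = y} p x∈ refl = x∈p─q⇒x∉q p ⁅ y ⁆ x∈ (x∈⁅x⁆ y)

∣p∪q∣+∣p∩q∣≡∣p∣+∣q∣ : ∀ (p q : Subset n) → ∣ p ∪ q ∣ + ∣ p ∩ q ∣ ≡ ∣ p ∣ + ∣ q ∣
∣p∪q∣+∣p∩q∣≡∣p∣+∣q∣ []            []            = refl
∣p∪q∣+∣p∩q∣≡∣p∣+∣q∣ (inside  ∷ p) (inside  ∷ q) =
  cong suc (trans (+-suc _ _) (trans (cong suc (∣p∪q∣+∣p∩q∣≡∣p∣+∣q∣ p q)) (sym (+-suc _ _))))
∣p∪q∣+∣p∩q∣≡∣p∣+∣q∣ (inside  ∷ p) (outside ∷ q) = cong suc (∣p∪q∣+∣p∩q∣≡∣p∣+∣q∣ p q)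
∣p∪q∣+∣p∩q∣≡∣p∣+∣q∣ (outside ∷ p) (inside  ∷ q) =
  trans (cong suc (∣p∪q∣+∣p∩q∣≡∣p∣+∣q∣ p q)) (sym (+-suc _ _))
∣p∪q∣+∣p∩q∣≡∣p∣+∣q∣ (outside ∷ p) (outside ∷ q) = ∣p∪q∣+∣p∩q∣≡∣p∣+∣q∣ p q

∣p∪q∣≤∣p∣+∣q∣ : ∀ (p q : Subset n) → ∣ p ∪ q ∣ ≤ ∣ p ∣ + ∣ q ∣
∣p∪q∣≤∣p∣+∣q∣ p q = ≤-trans (m≤m+n _ _) (≤-reflexive (∣p∪q∣+∣p∩q∣≡∣p∣+∣q∣ p q))

Empty[p∩q]⇒∣p∪q∣≡∣p∣+∣q∣ : ∀ (p q : Subset n) → Empty (p ∩ q) → ∣ p ∪ q ∣ ≡ ∣ p ∣ + ∣ q ∣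
Empty[p∩q]⇒∣p∪q∣≡∣p∣+∣q∣ {n} p q empty = begin
  ∣ p ∪ q ∣                ≡⟨ sym (+-identityʳ _) ⟩
  ∣ p ∪ q ∣ + 0            ≡⟨ cong (∣ p ∪ q ∣ +_) (sym (∣⊥∣≡0 n)) ⟩
  ∣ p ∪ q ∣ + ∣ ⊥ {n} ∣    ≡⟨ cong (λ r → ∣ p ∪ q ∣ + ∣ r ∣) (sym (Empty-unique empty)) ⟩
  ∣ p ∪ q ∣ + ∣ p ∩ q ∣    ≡⟨ ∣p∪q∣+∣p∩q∣≡∣p∣+∣q∣ p q ⟩
  ∣ p ∣ + ∣ q ∣            ∎
  where open ≡-Reasoning

∣p∩q∣≤1+∣p∩[q-x]∣ : ∀ (p q : Subset n) x → ∣ p ∩ q ∣ ≤ suc ∣ p ∩ (q - x) ∣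
∣p∩q∣≤1+∣p∩[q-x]∣ p q x = begin
  ∣ p ∩ q ∣                      ≤⟨ p⊆q⇒∣p∣≤∣q∣ split ⟩
  ∣ ⁅ x ⁆ ∪ p ∩ (q - x) ∣        ≤⟨ ∣p∪q∣≤∣p∣+∣q∣ ⁅ x ⁆ (p ∩ (q - x)) ⟩
  ∣ ⁅ x ⁆ ∣ + ∣ p ∩ (q - x) ∣    ≡⟨ cong (_+ ∣ p ∩ (q - x) ∣) (∣⁅x⁆∣≡1 x) ⟩
  suc ∣ p ∩ (q - x) ∣            ∎
  where
  open ≤-Reasoning
  split : p ∩ q ⊆ ⁅ x ⁆ ∪ p ∩ (q - x)
  split {y} y∈p∩q with y ≟ x
  ... | yes refl = x∈p∪q⁺ (inj₁ (x∈⁅x⁆ x))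
  ... | no  y≢x  = x∈p∪q⁺ (inj₂ (x∈p∩q⁺ (proj₁ y∈ , x∈p∧x≢y⇒x∈p-y (proj₂ y∈) y≢x)))
    where y∈ = x∈p∩q⁻ p q y∈p∩q

∣q∣<∣p∣⇒∃[x∈p─q] : ∀ (p q : Subset n) → ∣ q ∣ < ∣ p ∣ → ∃ λ x → x ∈ p × x ∉ q
∣q∣<∣p∣⇒∃[x∈p─q] {n} p q ∣q∣<∣p∣ with nonempty? (p ─ q)
... | yes (x , x∈p─q) = x , p─q⊆p p q x∈p─q , x∈p─q⇒x∉q p q x∈p─q
... | no  empty       = contradiction ∣q∣<∣p∣ (≤⇒≯ (begin
  ∣ p ∣                  ≤⟨ p⊆q⇒∣p∣≤∣q∣ split ⟩
  ∣ (p ─ q) ∪ q ∣        ≤⟨ ∣p∪q∣≤∣p∣+∣q∣ (p ─ q) q ⟩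
  ∣ p ─ q ∣ + ∣ q ∣      ≡⟨ cong (λ r → ∣ r ∣ + ∣ q ∣) (Empty-unique empty) ⟩
  ∣ ⊥ {n} ∣ + ∣ q ∣      ≡⟨ cong (_+ ∣ q ∣) (∣⊥∣≡0 n) ⟩
  ∣ q ∣                  ∎))
  where
  open ≤-Reasoning
  split : p ⊆ (p ─ q) ∪ q
  split {x} x∈p with x ∈? q
  ... | yes x∈q = x∈p∪q⁺ (inj₂ x∈q)
  ... | no  x∉q = x∈p∪q⁺ (inj₁ (x∈p∧x∉q⇒x∈p─q x∈p x∉q))

∣p∣>0⇒Nonempty : ∀ (p : Subset n) → 0 < ∣ p ∣ → Nonempty p
∣p∣>0⇒Nonempty {n} p ∣p∣>0 =
  let x , x∈p , _ = ∣q∣<∣p∣⇒∃[x∈p─q] p ⊥ (subst (_< ∣ p ∣) (sym (∣⊥∣≡0 n)) ∣p∣>0) in x , x∈p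

x∈tabulate⁻ : ∀ {f : Fin n → Bool} {x} → x ∈ tabulate f → f x ≡ true
x∈tabulate⁻ {f = f} {x} x∈ = trans (sym (lookup∘tabulate f x)) ([]=⇒lookup x∈)

image : (Fin m → Fin n) → Subset n
image {zero}  f = ⊥
image {suc m} f = ⁅ f zero ⁆ ∪ image (f ∘ suc)

∣image∣≤ : ∀ (f : Fin m → Fin n) → ∣ image f ∣ ≤ m
∣image∣≤ {zero} {n} f = ≤-reflexive (∣⊥∣≡0 n)
∣image∣≤ {suc m} f = ≤-trans (∣p∪q∣≤∣p∣+∣q∣ ⁅ f zero ⁆ (image (f ∘ suc)))
  (≤-trans (≤-reflexive (cong (_+ ∣ image (f ∘ suc) ∣) (∣⁅x⁆∣≡1 (f zero)))) (s≤s (∣image∣≤ (f ∘ suc))))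

f[i]∈image : ∀ (f : Fin m → Fin n) i → f i ∈ image f
f[i]∈image f zero    = x∈p∪q⁺ (inj₁ (x∈⁅x⁆ (f zero)))
f[i]∈image f (suc i) = x∈p∪q⁺ (inj₂ (f[i]∈image (f ∘ suc) i))

x∉image⇒f[i]≢x : ∀ (f : Fin m → Fin n) {x} → x ∉ image f → ∀ i → f i ≢ x
x∉image⇒f[i]≢x f x∉ i refl = x∉ (f[i]∈image f i)

x∈image⁻ : ∀ (f : Fin m → Fin n) {x} → x ∈ image f → ∃ λ i → f i ≡ x
x∈image⁻ {zero}  f x∈ = ⊥-elim (∉⊥ x∈)
x∈image⁻ {suc m} f x∈ with x∈p∪q⁻ ⁅ f zero ⁆ (image (f ∘ suc)) x∈
... | inj₁ x∈⁅f0⁆ = zero , sym (x∈⁅y⁆⇒x≡y (f zero) x∈⁅f0⁆)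
... | inj₂ x∈im   = let i , fi≡x = x∈image⁻ (f ∘ suc) x∈im in suc i , fi≡x

data InsertAtView {n} (i : Fin (suc n)) : Fin (suc n) → Set where
  inserted : InsertAtView i i
  shifted  : (j : Fin n) → InsertAtView i (punchIn i j)

insertAtView : (i j : Fin (suc n)) → InsertAtView i j
insertAtView i j with i ≟ j
... | yes refl = inserted
... | no  i≢j  = subst (InsertAtView i) (punchIn-punchOut i≢j) (shifted (punchOut i≢j))

module _ (_∼_ : X → Y → Set) (xs : Vector X n) (ys : Vector Y n) (i : Fin (suc n)) {x : X} {y : Y} where

  insertAt-pointwise : x ∼ y → (∀ j → xs j ∼ ys j) → ∀ j → insertAt xs i x j ∼ insertAt ys i y j
  insertAt-pointwise x∼y xs∼ys j with insertAtView i j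
  ... | inserted  rewrite insertAt-lookup xs i x | insertAt-lookup ys i y = x∼y
  ... | shifted j rewrite insertAt-punchIn xs i x j | insertAt-punchIn ys i y j = xs∼ys j

module _ (P : X → Set) (xs : Vector X n) (i : Fin (suc n)) {x : X} where

  insertAt-all : P x → (∀ j → P (xs j)) → ∀ j → P (insertAt xs i x j)
  insertAt-all = insertAt-pointwise (λ a _ → P a) xs xs i {x} {x}

module _ (_∼_ : X → Y → Set) (xs : Vector X n) (ys : Vector Y n) (i : Fin n) {y : Y} where

  updateAt-pointwise : xs i ∼ y → (∀ j → j ≢ i → xs j ∼ ys j) → ∀ j → xs j ∼ updateAt ys i (const y) j
  updateAt-pointwise xᵢ∼y xs∼ys j with j ≟ i
  ... | yes refl = subst (xs j ∼_) (sym (updateAt-updates i {const y} ys)) xᵢ∼y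
  ... | no  j≢i  = subst (xs j ∼_) (sym (updateAt-minimal j i {const y} ys j≢i)) (xs∼ys j j≢i)

module _ (P : X → Set) (xs : Vector X n) (i : Fin n) {x : X} where

  updateAt-all : P x → (∀ j → j ≢ i → P (xs j)) → ∀ j → P (updateAt xs i (const x) j)
  updateAt-all = updateAt-pointwise (λ _ → P) xs xs i

module _ {xs : Vector X n} (xs-injective : Injective _≡_ _≡_ xs) {x} (x∉xs : ∀ j → xs j ≢ x) where

  insertAt-injective : ∀ i → Injective _≡_ _≡_ (insertAt xs i x)
  insertAt-injective i {j} {k} eq with insertAtView i j | insertAtView i k
  ... | inserted  | inserted  = refl
  ... | inserted  | shifted k rewrite insertAt-lookup xs i x | insertAt-punchIn xs i x k = ⊥-elim (x∉xs k (sym eq))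
  ... | shifted j | inserted  rewrite insertAt-lookup xs i x | insertAt-punchIn xs i x j = ⊥-elim (x∉xs j eq)
  ... | shifted j | shifted k rewrite insertAt-punchIn xs i x j | insertAt-punchIn xs i x k =
    cong (punchIn i) (xs-injective eq)

  updateAt-injective : ∀ i → Injective _≡_ _≡_ (updateAt xs i (const x))
  updateAt-injective i {j} {k} eq with j ≟ i | k ≟ i
  ... | yes refl | yes refl = refl
  ... | yes refl | no k≢i
    rewrite updateAt-updates i {const x} xs | updateAt-minimal k i {const x} xs k≢i = ⊥-elim (x∉xs k (sym eq))
  ... | no j≢i | yes refl
    rewrite updateAt-updates i {const x} xs | updateAt-minimal j i {const x} xs j≢i = ⊥-elim (x∉xs j eq)
  ... | no j≢i | no k≢i
    rewrite updateAt-minimal j i {const x} xs j≢i | updateAt-minimal k i {const x} xs k≢i = xs-injective eq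

module _ {n} (E : Digraph n) where

  Out In : Fin n → Subset n
  Out u = tabulate (E u)
  In  u = tabulate (λ v → E v u)

  SemiDegWithin : Subset n → ℕ → Set
  SemiDegWithin A t = ∀ {u} → u ∈ A → t ≤ ∣ Out u ∩ A ∣ × t ≤ ∣ In u ∩ A ∣

  minSemiDeg⇒semiDegWithin⊤ : ∀ {t} → MinSemiDegAtLeast E t → SemiDegWithin ⊤ t
  minSemiDeg⇒semiDegWithin⊤ δ {u} _ rewrite ∩-identityʳ (Out u) | ∩-identityʳ (In u) = δ u

  semiDegWithin-remove : ∀ {A t} x → SemiDegWithin A (suc t) → SemiDegWithin (A - x) t
  semiDegWithin-remove {A} x deg {u} u∈A-x =
    let d⁺ , d⁻ = deg (p─q⊆p A ⁅ x ⁆ u∈A-x)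
    in ≤-pred (≤-trans d⁺ (∣p∩q∣≤1+∣p∩[q-x]∣ (Out u) A x)) ,
       ≤-pred (≤-trans d⁻ (∣p∩q∣≤1+∣p∩[q-x]∣ (In u) A x))

  outNeighbourWithin : ∀ {A t u} → SemiDegWithin A (suc t) → u ∈ A → ∃ λ v → Edge E u v × v ∈ A
  outNeighbourWithin {A} {u = u} deg u∈A =
    let v , v∈ = ∣p∣>0⇒Nonempty (Out u ∩ A) (≤-trans (s≤s z≤n) (proj₁ (deg u∈A)))
        v∈Out , v∈A = x∈p∩q⁻ (Out u) A v∈
    in v , x∈tabulate⁻ v∈Out , v∈A

  record AntimatchingWithin (k : ℕ) (A : Subset n) (w : Fin n) : Set where
    field
      a b         : Fin (suc k) → Fin n
      isEdge      : ∀ i → Edge E (a i) (b i)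
      a-injective : Injective _≡_ _≡_ a
      b-injective : Injective _≡_ _≡_ b
      a≢b         : ∀ i j → a i ≢ b j
      reachable   : ∀ i → OutOutWalk E w (a i)
      a₀≡w        : a zero ≡ w
      a∈A         : ∀ i → a i ∈ A
      b∈A         : ∀ i → b i ∈ A

  antimatchingWithin-mono : ∀ {k A B w} → A ⊆ B → AntimatchingWithin k A w → AntimatchingWithin k B w
  antimatchingWithin-mono A⊆B M = record
    { a = a ; b = b ; isEdge = isEdge ; a-injective = a-injective ; b-injective = b-injective
    ; a≢b = a≢b ; reachable = reachable ; a₀≡w = a₀≡w
    ; a∈A = λ i → A⊆B (a∈A i) ; b∈A = λ i → A⊆B (b∈A i) }
    where open AntimatchingWithin M

  module _ {k A w} (M : AntimatchingWithin k A w) where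
    open AntimatchingWithin M

    Fresh : Fin n → Set
    Fresh v = (∀ i → a i ≢ v) × (∀ i → b i ≢ v)

    redirect : ∀ j {v} → Edge E (a j) v → v ∈ A → Fresh v → AntimatchingWithin k A w
    redirect j {v} aj→v v∈A (a≢v , b≢v) = record
      { a           = a
      ; b           = updateAt b j (const v)
      ; isEdge      = updateAt-pointwise (Edge E) a b j aj→v (λ i _ → isEdge i)
      ; a-injective = a-injective
      ; b-injective = updateAt-injective b-injective b≢v j
      ; a≢b         = λ i → updateAt-all (a i ≢_) b j (a≢v i) (λ i′ _ → a≢b i i′)
      ; reachable   = reachable
      ; a₀≡w        = a₀≡w
      ; a∈A         = a∈A
      ; b∈A         = updateAt-all (_∈ A) b j v∈A (λ i _ → b∈A i)
      }

  module _ (oriented : Oriented E) where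

    edge⇒≢ : ∀ {u v} → Edge E u v → u ≢ v
    edge⇒≢ u→v refl = proj₁ oriented _ u→v

    semiDegWithin⇒∣neighbours∣ : ∀ {A t u} → SemiDegWithin A t → u ∈ A → t + t ≤ ∣ Out u ∩ A ∪ In u ∩ A ∣
    semiDegWithin⇒∣neighbours∣ {A} {u = u} deg u∈A =
      subst (_ ≤_) (sym (Empty[p∩q]⇒∣p∪q∣≡∣p∣+∣q∣ (Out u ∩ A) (In u ∩ A) disjoint))
        (+-mono-≤ (proj₁ (deg u∈A)) (proj₂ (deg u∈A)))
      where
      disjoint : Empty ((Out u ∩ A) ∩ (In u ∩ A))
      disjoint (v , v∈) =
        let v∈Out∩A , v∈In∩A = x∈p∩q⁻ (Out u ∩ A) (In u ∩ A) v∈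
        in proj₂ oriented u v (x∈tabulate⁻ (proj₁ (x∈p∩q⁻ (Out u) A v∈Out∩A)))
                              (x∈tabulate⁻ (proj₁ (x∈p∩q⁻ (In u) A v∈In∩A)))

    -- Inserting at position 1 leaves a zero, hence a₀≡w, untouched.
    insertPair : ∀ {k A w} (M : AntimatchingWithin k A w) {p q} → Edge E p q → OutOutWalk E w p →
                 p ∈ A → q ∈ A → Fresh M p → Fresh M q → AntimatchingWithin (suc k) A w
    insertPair {k} {A} {w} M {p} {q} p→q w⇝p p∈A q∈A (a≢p , b≢p) (a≢q , b≢q) = record
      { a           = a′
      ; b           = b′
      ; isEdge      = insertAt-pointwise (Edge E) a b (suc zero) p→q isEdge
      ; a-injective = insertAt-injective a-injective a≢p (suc zero)
      ; b-injective = insertAt-injective b-injective b≢q (suc zero)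
      ; a≢b         = a′≢b′
      ; reachable   = insertAt-all (OutOutWalk E w) a (suc zero) w⇝p reachable
      ; a₀≡w        = a₀≡w
      ; a∈A         = insertAt-all (_∈ A) a (suc zero) p∈A a∈A
      ; b∈A         = insertAt-all (_∈ A) b (suc zero) q∈A b∈A
      }
      where
      open AntimatchingWithin M
      a′ b′ : Fin (suc (suc k)) → Fin n
      a′ = insertAt a (suc zero) p
      b′ = insertAt b (suc zero) q
      a′≢q : ∀ i → a′ i ≢ q
      a′≢q = insertAt-all (_≢ q) a (suc zero) (edge⇒≢ p→q) a≢q
      a′≢b′ : ∀ i j → a′ i ≢ b′ j
      a′≢b′ i = insertAt-all (a′ i ≢_) b (suc zero) (a′≢q i)
        (λ j → insertAt-all (_≢ b j) a (suc zero) (λ p≡bj → b≢p j (sym p≡bj)) (λ i′ → a≢b i′ j) i)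

    module AddPair {k A w y} (deg : SemiDegWithin A (suc (suc k))) (w→y : Edge E w y) (y∈A : y ∈ A)
                   (M : AntimatchingWithin k (A - y) w) where
      open AntimatchingWithin M

      M⁺ : AntimatchingWithin k A w
      M⁺ = antimatchingWithin-mono (p─q⊆p A ⁅ y ⁆) M

      y-fresh : Fresh M⁺ y
      y-fresh = (λ i → x∈p-y⇒x≢y A (a∈A i)) , (λ i → x∈p-y⇒x≢y A (b∈A i))

      blocker : Fin (suc k) → Fin n
      blocker j = if E (b j) y then b j else a j

      blocker≡ : ∀ j {c} → E (b j) y ≡ c → blocker j ≡ (if c then b j else a j)
      blocker≡ j refl = refl

      partner→y : ∀ j → a j ∉ image blocker → Edge E (b j) y
      partner→y j aj∉ with E (b j) y in eq
      ... | true  = refl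
      ... | false = contradiction (subst (_∈ image blocker) (blocker≡ j eq) (f[i]∈image blocker j)) aj∉

      b∈blocker : ∀ j → Edge E (b j) y → b j ∈ image blocker
      b∈blocker j bj→y = subst (_∈ image blocker) (blocker≡ j bj→y) (f[i]∈image blocker j)

      module FreedEnd j (aj→y : Edge E (a j) y) (c→y : Edge E (b j) y) where
        c : Fin n
        c = b j

        c∈A : c ∈ A
        c∈A = p─q⊆p A ⁅ y ⁆ (b∈A j)

        M′ : AntimatchingWithin k A w
        M′ = redirect M⁺ j aj→y y∈A y-fresh

        c-fresh : Fresh M′ c
        c-fresh = (λ i → a≢b i j) ,
          updateAt-all (_≢ c) b j (λ y≡c → proj₂ y-fresh j (sym y≡c)) (λ i i≢j bi≡c → i≢j (b-injective bi≡c))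

        neighbours forbidden : Subset n
        neighbours = Out c ∩ A ∪ In c ∩ A
        forbidden  = ⁅ y ⁆ ∪ image a ∪ image b

        ∣forbidden∣<∣neighbours∣ : ∣ forbidden ∣ < ∣ neighbours ∣
        ∣forbidden∣<∣neighbours∣ = begin-strict
          ∣ forbidden ∣                         ≤⟨ ∣p∪q∣≤∣p∣+∣q∣ ⁅ y ⁆ (image a ∪ image b) ⟩
          ∣ ⁅ y ⁆ ∣ + ∣ image a ∪ image b ∣     ≡⟨ cong (_+ ∣ image a ∪ image b ∣) (∣⁅x⁆∣≡1 y) ⟩
          suc ∣ image a ∪ image b ∣             ≤⟨ s≤s (∣p∪q∣≤∣p∣+∣q∣ (image a) (image b)) ⟩
          suc (∣ image a ∣ + ∣ image b ∣)       ≤⟨ s≤s (+-mono-≤ (∣image∣≤ a) (∣image∣≤ b)) ⟩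
          suc (suc k + suc k)                   <⟨ s≤s (+-monoʳ-< (suc k) (n<1+n (suc k))) ⟩
          suc (suc k) + suc (suc k)             ≤⟨ semiDegWithin⇒∣neighbours∣ deg c∈A ⟩
          ∣ neighbours ∣                        ∎
          where open ≤-Reasoning

        z-fresh : ∀ {z} → z ∉ forbidden → Fresh M′ z
        z-fresh {z} z∉ =
          x∉image⇒f[i]≢x a (λ z∈a → z∉ (x∈p∪q⁺ (inj₂ (x∈p∪q⁺ (inj₁ z∈a))))) ,
          updateAt-all (_≢ z) b j (λ { refl → z∉ (x∈p∪q⁺ (inj₁ (x∈⁅x⁆ y))) })
            (λ i _ → x∉image⇒f[i]≢x b (λ z∈b → z∉ (x∈p∪q⁺ (inj₂ (x∈p∪q⁺ (inj₂ z∈b))))) i)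

        viaNeighbour : ∀ {z} → z ∈ neighbours → z ∉ forbidden → AntimatchingWithin (suc k) A w
        viaNeighbour z∈ z∉ with x∈p∪q⁻ (Out c ∩ A) (In c ∩ A) z∈
        ... | inj₁ z∈Out∩A = let z∈Out , z∈A = x∈p∩q⁻ (Out c) A z∈Out∩A in
          insertPair M′ (x∈tabulate⁻ z∈Out) (extend trivial w→y c→y) c∈A z∈A c-fresh (z-fresh z∉)
        ... | inj₂ z∈In∩A = let z∈In , z∈A = x∈p∩q⁻ (In c) A z∈In∩A ; z→c = x∈tabulate⁻ z∈In in
          insertPair M′ z→c (extend (reachable j) (isEdge j) z→c) z∈A c∈A (z-fresh z∉) c-fresh

        result : AntimatchingWithin (suc k) A w
        result = let _ , z∈ , z∉ = ∣q∣<∣p∣⇒∃[x∈p─q] neighbours forbidden ∣forbidden∣<∣neighbours∣ in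
          viaNeighbour z∈ z∉

      viaInNeighbour : ∀ {x} → Edge E x y → x ∈ A → x ∉ image blocker → AntimatchingWithin (suc k) A w
      viaInNeighbour {x} x→y x∈A x∉blocker with x ∈? image a | x ∈? image b
      ... | yes x∈a | _ with x∈image⁻ a x∈a
      ...   | j , refl = FreedEnd.result j x→y (partner→y j x∉blocker)
      viaInNeighbour {x} x→y x∈A x∉blocker | no _ | yes x∈b with x∈image⁻ b x∈b
      ...   | j , refl = contradiction (b∈blocker j x→y) x∉blocker
      viaInNeighbour {x} x→y x∈A x∉blocker | no x∉a | no x∉b =
        insertPair M⁺ x→y (extend trivial w→y x→y) x∈A y∈A
          (x∉image⇒f[i]≢x a x∉a , x∉image⇒f[i]≢x b x∉b) y-fresh

      result : AntimatchingWithin (suc k) A w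
      result =
        let x , x∈In∩A , x∉blocker = ∣q∣<∣p∣⇒∃[x∈p─q] (In y ∩ A) (image blocker)
                                       (≤-<-trans (∣image∣≤ blocker) (proj₂ (deg y∈A)))
            x∈In , x∈A = x∈p∩q⁻ (In y) A x∈In∩A
        in viaInNeighbour (x∈tabulate⁻ x∈In) x∈A x∉blocker

    antimatchingWithin : ∀ k {A w} → SemiDegWithin A (suc k) → w ∈ A → AntimatchingWithin k A w
    antimatchingWithin zero {w = w} deg w∈A =
      let y , w→y , y∈A = outNeighbourWithin deg w∈A in record
        { a = const w ; b = const y ; isEdge = const w→y
        ; a-injective = λ { {zero} {zero} _ → refl } ; b-injective = λ { {zero} {zero} _ → refl }
        ; a≢b = λ _ _ → edge⇒≢ w→y ; reachable = const trivial ; a₀≡w = refl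
        ; a∈A = const w∈A ; b∈A = const y∈A }
    antimatchingWithin (suc k) deg w∈A =
      let y , w→y , y∈A = outNeighbourWithin deg w∈A
      in AddPair.result deg w→y y∈A
           (antimatchingWithin k (semiDegWithin-remove y deg) (x∈p∧x≢y⇒x∈p-y w∈A (edge⇒≢ w→y)))

lemma7 : (k : ℕ) (n : ℕ) (E : Digraph n) → Oriented E →
         MinSemiDegAtLeast E (suc k) → (w : Fin n) →
         Σ (ConnectedAntimatching E k) (λ M → ConnectedAntimatching.a M zero ≡ w)
lemma7 k n E oriented δ w = record
  { a = a ; b = b ; isEdge = isEdge ; a-inj = λ _ _ → a-injective ; b-inj = λ _ _ → b-injective
  ; a≢b = a≢b ; connected = λ i → subst (λ v → OutOutWalk E v (a i)) (sym a₀≡w) (reachable i) } , a₀≡w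
  where
  open AntimatchingWithin
    (antimatchingWithin E oriented k (minSemiDeg⇒semiDegWithin⊤ E δ) (∈⊤ {x = w}))
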